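{- Let $M=\langle W,R,\vartheta\rangle$ be an $\mathrm{LC}^{\triangleright}$-model and $\varphi$ a formula. If some world $w\in W$ satisfies $M,w\not\Vdash\varphi$, then there is a world $v\in W$ with $M,v\not\Vdash\varphi$ and $M,v\Vdash\triangleright\varphi$ (a "last refuter" of $\varphi$).
   Context: Formulae: $\varphi ::= p \mid \top \mid \bot \mid \varphi\land\varphi \mid \varphi\lor\varphi \mid \varphi\to\varphi \mid \varphi\Rightarrow\varphi \mid \triangleright\varphi$ with $p$ atomic. An $\mathrm{LC}^{\triangleright}$-frame is $\langle W,R\rangle$, $W$ nonempty, $R$ transitive, converse-well-founded (no infinite $x_1Rx_2R\cdots$) and connected ($x=y$ or $xRy$ or $yRx$). A model adds a valuation $\vartheta$ (atoms to subsets of $W$) with persistence: $w\in\vartheta(p)$, $wRx$ imply $x\in\vartheta(p)$. With $R^{=}$ the reflexive closure of $R$: $M,w\Vdash p$ iff $w\in\vartheta(p)$; $\top,\bot,\land,\lor$ as usual; $M,w\Vdash\varphi\to\psi$ iff for all $x$ with $wR^{=}x$, $M,x\Vdash\varphi$ implies $M,x\Vdash\psi$; $M,w\Vdash\varphi\Rightarrow\psi$ iff for all $x$ with $wRx$, $M,x\Vdash\varphi$ implies $M,x\Vdash\psi$; $M,w\Vdash\triangleright\varphi$ iff $M,x\Vdash\varphi$ for all $x$ with $wRx$. -}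

module Defs where

open import Data.Nat using (ℕ; suc)
open import Data.Unit using (⊤)
open import Data.Empty using (⊥)
open import Data.Product using (_×_; Σ)
open import Data.Sum using (_⊎_)
open import Relation.Nullary using (¬_)
open import Relation.Binary.PropositionalEquality using (_≡_)

Atom : Set
Atom = ℕ

infixr 5 _⇒_ _⟶_
infixr 6 _∨_
infixr 7 _∧_
data Form : Set where
  var  : Atom → Form
  ⊤f   : Form
  ⊥f   : Form
  _∧_  : Form → Form → Form
  _∨_  : Form → Form → Form
  _⟶_  : Form → Form → Form   -- intuitionistic implication  →
  _⇒_  : Form → Form → Form   -- strict implication  ⇒
  ▹_   : Form → Form

record Frame : Set₁ where
  field
    W        : Set
    R        : W → W → Set
    inhabited : W
    trans    : ∀ {x y z} → R x y → R y z → R x z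
    cwf      : ¬ (Σ (ℕ → W) λ f → ∀ n → R (f n) (f (suc n)))
    connected : ∀ x y → (x ≡ y) ⊎ (R x y ⊎ R y x)

record Model : Set₁ where
  field
    frame : Frame
  open Frame frame public
  field
    val     : Atom → W → Set
    persist : ∀ {p w x} → val p w → R w x → val p x

module _ (M : Model) where
  open Model M

  R⁼ : W → W → Set
  R⁼ w x = (w ≡ x) ⊎ R w x

  _⊩_ : W → Form → Set
  w ⊩ var p   = val p w
  w ⊩ ⊤f      = ⊤
  w ⊩ ⊥f      = ⊥
  w ⊩ (φ ∧ ψ) = (w ⊩ φ) × (w ⊩ ψ)
  w ⊩ (φ ∨ ψ) = (w ⊩ φ) ⊎ (w ⊩ ψ)
  w ⊩ (φ ⟶ ψ) = ∀ x → R⁼ w x → x ⊩ φ → x ⊩ ψ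
  w ⊩ (φ ⇒ ψ) = ∀ x → R w x → x ⊩ φ → x ⊩ ψ
  w ⊩ (▹ φ)   = ∀ x → R w x → x ⊩ φ

-- The theorem is an instance of a purely order-theoretic fact: on a
-- relation R with no infinite ascending chain x₀ R x₁ R x₂ R ⋯, every
-- predicate P that holds somewhere has an R-maximal witness, i.e. a v
-- with P v and no R-successor of v satisfying P.  Classically this is
-- proved by contradiction: if no witness were maximal, every witness
-- would have a witness as R-successor, and iterating that choice from
-- the given witness would produce an infinite ascending chain.
--
-- Taking P v to be "v refutes φ" in an
-- LC▷-model, a maximal refuter v has every R-successor forcing φ (again
-- by double negation elimination), which is exactly v ⊩ ▹ φ.
module Submission where

open import Defs
open import Level using (0ℓ)
open import Axiom.ExcludedMiddle using (ExcludedMiddle)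
open import Axiom.DoubleNegationElimination
  using (DoubleNegationElimination; em⇒dne)
open import Data.Product using (Σ; _×_; _,_; proj₁; proj₂)
open import Data.Nat using (ℕ; zero; suc)
open import Relation.Nullary using (¬_)

AscendingChain : {A : Set} → (A → A → Set) → Set
AscendingChain {A} R = Σ (ℕ → A) λ f → ∀ n → R (f n) (f (suc n))

chainFrom : {A : Set} (R : A → A → Set) (P : A → Set) →
  (next : ∀ a → P a → Σ A λ b → P b × R a b) →
  ∀ a → P a → AscendingChain R
chainFrom {A} R P next a pa = point , step
  where
    pointWithProof : ℕ → Σ A P
    pointWithProof zero    = a , pa
    pointWithProof (suc n) with pointWithProof n
    ... | b , pb = proj₁ (next b pb) , proj₁ (proj₂ (next b pb))

    point : ℕ → A
    point n = proj₁ (pointWithProof n)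

    step : ∀ n → R (point n) (point (suc n))
    step n = proj₂ (proj₂ (next (point n) (proj₂ (pointWithProof n))))

maximalWitness : DoubleNegationElimination 0ℓ →
  {A : Set} (R : A → A → Set) → ¬ AscendingChain R →
  (P : A → Set) → ∀ a → P a →
  Σ A λ v → P v × (∀ x → R v x → ¬ P x)
maximalWitness dne R noChain P a pa =
  dne λ noMaximal → noChain (chainFrom R P (successor noMaximal) a pa)
  where
    successor : ¬ (Σ _ λ v → P v × (∀ x → R v x → ¬ P x)) →
      ∀ b → P b → Σ _ λ c → P c × R b c
    successor noMaximal b pb =
      dne λ noSuccessor →
        noMaximal (b , pb , λ c rbc pc → noSuccessor (c , pc , rbc))

lemma3 : ExcludedMiddle 0ℓ → (M : Model) → (φ : Form) →
    (w : Model.W M) → ¬ (_⊩_ M w φ) →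
    Σ (Model.W M) λ v → ¬ (_⊩_ M v φ) × _⊩_ M v (▹ φ)
lemma3 em M φ w w⊮φ =
  lastRefuter (maximalWitness dne R cwf (λ v → ¬ (v ⊩′ φ)) w w⊮φ)
  where
    open Model M using (W; R; cwf)

    _⊩′_ : W → Form → Set
    _⊩′_ = _⊩_ M

    dne : DoubleNegationElimination 0ℓ
    dne = em⇒dne em

    lastRefuter : Σ W (λ v → ¬ (v ⊩′ φ) × (∀ x → R v x → ¬ ¬ (x ⊩′ φ))) →
                  Σ W λ v → ¬ (v ⊩′ φ) × (v ⊩′ (▹ φ))
    lastRefuter (v , v⊮φ , successorsForce) =
      v , v⊮φ , λ x rvx → dne (successorsForce x rvx)
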